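{- Let $R$ be a ring (with identity) and let $\tau\mapsto\overline{\tau}$ be an anti-automorphism of $R$ satisfying the two conditions: (i) $\tau\overline{\tau}=\overline{\tau}\tau$ for all $\tau\in R$; (ii) if $\overline{\tau}=\tau$ then $\tau$ belongs to the centre of $R$. Let $(q_1,\ldots,q_n)$ be a quasi-palindromic sequence of elements of $R$ of length $n\ge 2$. Then \[ [q_1,\ldots,q_n][q_2,\ldots,q_{n-1}]=[q_2,\ldots,q_n][q_1,\ldots,q_{n-1}]+(-1)^n=[q_1,\ldots,q_{n-1}][q_2,\ldots,q_n]+(-1)^n . \]
   Context: For a sequence $(q_1,\ldots,q_n)$ of elements of a ring $R$, the continuant $[q_1,\ldots,q_n]\in R$ is defined recursively by $[\,]=1$ (empty sequence), $[q_1]=q_1$, $[q_1,q_2]=q_1q_2+1$, and $[q_1,\ldots,q_n]=[q_1,\ldots,q_{n-1}]q_n+[q_1,\ldots,q_{n-2}]$ for $n\ge 3$. An anti-automorphism of $R$ is an involution $\tau\mapsto\overline{\tau}$ with $\overline{\tau+\sigma}=\overline{\tau}+\overline{\sigma}$ and $\overline{\tau\sigma}=\overline{\sigma}\,\overline{\tau}$ for all $\tau,\sigma\in R$. A sequence $(q_1,\ldots,q_n)$ is quasi-palindromic if $q_i=\overline{q_{n+1-i}}$ for $1\le i\le n$ (so if $n$ is odd, the middle term satisfies $q_{(n+1)/2}=\overline{q_{(n+1)/2}}$). -}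

module Defs where

open import Level using (Level; _⊔_)
open import Algebra.Bundles using (Ring)
open import Data.Nat using (ℕ; zero; suc)
open import Data.Fin using (Fin; zero; suc; inject₁; opposite; fromℕ)

module _ {c ℓ : Level} (R : Ring c ℓ) where
  open Ring R using (Carrier; _≈_; _+_; _*_; -_; 1#)

  continuant : (m : ℕ) → (Fin m → Carrier) → Carrier
  continuant zero q = 1#
  continuant (suc zero) q = q zero
  continuant (suc (suc m)) q =
    continuant (suc m) (λ i → q (inject₁ i)) * q (fromℕ (suc m))
      + continuant m (λ i → q (inject₁ (inject₁ i)))

  sign : ℕ → Carrier
  sign zero = 1#
  sign (suc m) = - (sign m)

  record AntiAutomorphism : Set (c ⊔ ℓ) where
    field
      bar        : Carrier → Carrier
      bar-cong   : ∀ {x y} → x ≈ y → bar x ≈ bar y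
      involutive : ∀ x → bar (bar x) ≈ x
      bar-+      : ∀ x y → bar (x + y) ≈ bar x + bar y
      bar-*      : ∀ x y → bar (x * y) ≈ bar y * bar x

  QuasiPalindromic : AntiAutomorphism → (n : ℕ) → (Fin n → Carrier) → Set ℓ
  QuasiPalindromic A n q = ∀ i → q i ≈ AntiAutomorphism.bar A (q (opposite i))

{-# OPTIONS --safe #-}
-- Write q = (a, q₂, …, q_{n−1}, e), so a = ē.  Expanding the outer continuants at
-- both ends expresses them through a, e and the continuants of the inner sequence
-- (q₂,…,q_{n−1}), which is again quasi-palindromic.  Hence its continuant X equals
-- its conjugate and is central by (ii), while normality (i) gives ae = ea and,
-- polarised, lets the end letters a, e move past the inner continuants.  With these
-- commutations the identity for q is a ring computation from the identity for the
-- inner sequence, so the theorem follows by induction on n in steps of two.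
module Submission where

open import Defs
open import Level using (Level)
open import Algebra.Bundles using (Ring)
open import Data.Nat using (ℕ; zero; suc)
open import Data.Fin using (Fin; zero; suc; inject₁; fromℕ; opposite)
open import Data.Product using (_×_; _,_; proj₁; proj₂; map₂)
open import Function using (_∘_)
open import Relation.Binary.PropositionalEquality as ≡ using (_≡_)
import Algebra.Properties.Group as GroupProperties
import Algebra.Properties.CommutativeSemigroup as CommutativeSemigroupProperties

opposite-inject₁ : ∀ {n} (i : Fin (suc n)) → opposite (inject₁ i) ≡ suc (opposite i)
opposite-inject₁ {zero}  zero    = ≡.refl
opposite-inject₁ {suc n} zero    = ≡.refl
opposite-inject₁ {suc n} (suc i) = ≡.cong inject₁ (opposite-inject₁ i)

module RingLemmas {c ℓ : Level} (R : Ring c ℓ) where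
  open Ring R hiding (zero)
  open GroupProperties +-group using (∙-cancelˡ)
  open CommutativeSemigroupProperties +-commutativeSemigroup using (interchange)
  open import Relation.Binary.Reasoning.Setoid setoid

  +-cancel-≈ˡ : ∀ {u u′ v v′} → u + v ≈ u′ + v′ → u ≈ u′ → v ≈ v′
  +-cancel-≈ˡ {u} {u′} {v} {v′} u+v≈u′+v′ u≈u′ =
    ∙-cancelˡ u v v′ (trans u+v≈u′+v′ (+-congʳ (sym u≈u′)))

  foil : ∀ x y z w → (x + y) * (z + w) ≈ (x * z + y * w) + (x * w + y * z)
  foil x y z w = begin
    (x + y) * (z + w)                  ≈⟨ distribʳ _ _ _ ⟩
    x * (z + w) + y * (z + w)          ≈⟨ +-cong (distribˡ _ _ _) (distribˡ _ _ _) ⟩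
    (x * z + x * w) + (y * z + y * w)  ≈⟨ +-congˡ (+-comm _ _) ⟩
    (x * z + x * w) + (y * w + y * z)  ≈⟨ interchange _ _ _ _ ⟩
    (x * z + y * w) + (x * w + y * z)  ∎

  continuant-cong : ∀ m {x y : Fin m → Carrier} → (∀ i → x i ≈ y i) →
                    continuant R m x ≈ continuant R m y
  continuant-cong zero          x≈y = refl
  continuant-cong (suc zero)    x≈y = x≈y zero
  continuant-cong (suc (suc m)) x≈y =
    +-cong (*-cong (continuant-cong (suc m) (x≈y ∘ inject₁)) (x≈y (fromℕ (suc m))))
           (continuant-cong m (x≈y ∘ inject₁ ∘ inject₁))

  continuant-unfoldˡ : ∀ m (x : Fin (suc (suc m)) → Carrier) →
    continuant R (suc (suc m)) x
      ≈ x zero * continuant R (suc m) (λ i → x (suc i))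
        + continuant R m (λ i → x (suc (suc i)))
  continuant-unfoldˡ zero          x = refl
  continuant-unfoldˡ (suc zero)    x = begin
    (x₀ * x₁ + 1#) * x₂ + x₀          ≈⟨ +-congʳ (distribʳ _ _ _) ⟩
    (x₀ * x₁ * x₂ + 1# * x₂) + x₀     ≈⟨ +-assoc _ _ _ ⟩
    x₀ * x₁ * x₂ + (1# * x₂ + x₀)     ≈⟨ +-cong (*-assoc _ _ _) (+-comm _ _) ⟩
    x₀ * (x₁ * x₂) + (x₀ + 1# * x₂)   ≈⟨ +-congˡ (+-cong (sym (*-identityʳ _)) (*-identityˡ _)) ⟩
    x₀ * (x₁ * x₂) + (x₀ * 1# + x₂)   ≈⟨ sym (+-assoc _ _ _) ⟩
    (x₀ * (x₁ * x₂) + x₀ * 1#) + x₂   ≈⟨ +-congʳ (sym (distribˡ _ _ _)) ⟩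
    x₀ * (x₁ * x₂ + 1#) + x₂          ∎
    where
    x₀ = x zero
    x₁ = x (suc zero)
    x₂ = x (suc (suc zero))
  continuant-unfoldˡ (suc (suc m)) x = begin
    continuant R (suc (suc (suc m))) (x ∘ inject₁) * x (fromℕ (suc (suc (suc m))))
      + continuant R (suc (suc m)) (x ∘ inject₁ ∘ inject₁)
      ≈⟨ +-cong (*-congʳ (continuant-unfoldˡ (suc m) (x ∘ inject₁)))
                (continuant-unfoldˡ m (x ∘ inject₁ ∘ inject₁)) ⟩
    _ ≈⟨ regroup _ _ _ _ _ _ ⟩
    _ ∎
    where
    regroup : ∀ a u v w u′ v′ →
              (a * u + v) * w + (a * u′ + v′) ≈ a * (u * w + u′) + (v * w + v′)
    regroup a u v w u′ v′ = begin
      (a * u + v) * w + (a * u′ + v′)        ≈⟨ +-congʳ (distribʳ w (a * u) v) ⟩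
      (a * u * w + v * w) + (a * u′ + v′)    ≈⟨ +-congʳ (+-congʳ (*-assoc a u w)) ⟩
      (a * (u * w) + v * w) + (a * u′ + v′)  ≈⟨ interchange _ _ _ _ ⟩
      (a * (u * w) + a * u′) + (v * w + v′)  ≈⟨ +-congʳ (sym (distribˡ a (u * w) u′)) ⟩
      a * (u * w + u′) + (v * w + v′)        ∎

  -- For q = (a, q₂, …, q_{n−1}, e) the variables stand for
  -- X = [q₂,…,q_{n−1}], Y = [q₃,…,q_{n−1}], Z = [q₂,…,q_{n−2}], W = [q₃,…,q_{n−2}],
  -- C = [q₁,…,q_{n−1}], B = [q₂,…,qₙ] and P = [q₁,…,qₙ].
  determinant-step :
    ∀ {X a e Y Z W s P C B} →
    (∀ σ → X * σ ≈ σ * X) → a * e ≈ e * a → Y * e + a * Z ≈ e * Y + Z * a →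
    X * W ≈ Y * Z + s → Y * Z ≈ Z * Y →
    P ≈ C * e + (a * Z + W) → C ≈ a * X + Y → B ≈ X * e + Z →
    P * X ≈ B * C + s × B * C ≈ C * B
  determinant-step {X} {a} {e} {Y} {Z} {W} {s} {P} {C} {B}
                   X-central ae≈ea swap XW≈YZ+s YZ≈ZY P≈ C≈ B≈ =
    P*X≈B*C+s , B*C≈C*B
    where
    aX-comm-e : a * X * e ≈ e * (a * X)
    aX-comm-e = begin
      a * X * e    ≈⟨ *-assoc _ _ _ ⟩
      a * (X * e)  ≈⟨ *-congˡ (X-central e) ⟩
      a * (e * X)  ≈⟨ sym (*-assoc _ _ _) ⟩
      a * e * X    ≈⟨ *-congʳ ae≈ea ⟩
      e * a * X    ≈⟨ *-assoc _ _ _ ⟩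
      e * (a * X)  ∎

    C-swap : C * e + a * Z ≈ e * C + Z * a
    C-swap = begin
      C * e + a * Z                   ≈⟨ +-congʳ (trans (*-congʳ C≈) (distribʳ _ _ _)) ⟩
      (a * X * e + Y * e) + a * Z     ≈⟨ +-assoc _ _ _ ⟩
      a * X * e + (Y * e + a * Z)     ≈⟨ +-cong aX-comm-e swap ⟩
      e * (a * X) + (e * Y + Z * a)   ≈⟨ sym (+-assoc _ _ _) ⟩
      (e * (a * X) + e * Y) + Z * a   ≈⟨ +-congʳ (trans (sym (distribˡ _ _ _)) (*-congˡ (sym C≈))) ⟩
      e * C + Z * a                   ∎

    B*C≈ : B * C ≈ X * (e * C + Z * a) + Z * Y
    B*C≈ = begin
      B * C                                 ≈⟨ trans (*-congʳ B≈) (distribʳ _ _ _) ⟩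
      X * e * C + Z * C                     ≈⟨ +-cong (*-assoc _ _ _) (*-congˡ C≈) ⟩
      X * (e * C) + Z * (a * X + Y)         ≈⟨ +-congˡ (distribˡ _ _ _) ⟩
      X * (e * C) + (Z * (a * X) + Z * Y)   ≈⟨ +-congˡ (+-congʳ (trans (sym (*-assoc _ _ _)) (sym (X-central _)))) ⟩
      X * (e * C) + (X * (Z * a) + Z * Y)   ≈⟨ sym (+-assoc _ _ _) ⟩
      (X * (e * C) + X * (Z * a)) + Z * Y   ≈⟨ +-congʳ (sym (distribˡ _ _ _)) ⟩
      X * (e * C + Z * a) + Z * Y           ∎

    C*B≈ : C * B ≈ X * (C * e + a * Z) + Y * Z
    C*B≈ = begin
      C * B                                 ≈⟨ trans (*-congˡ B≈) (distribˡ _ _ _) ⟩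
      C * (X * e) + C * Z                   ≈⟨ +-cong CX-comm (*-congʳ C≈) ⟩
      X * (C * e) + (a * X + Y) * Z         ≈⟨ +-congˡ (distribʳ _ _ _) ⟩
      X * (C * e) + (a * X * Z + Y * Z)     ≈⟨ +-congˡ (+-congʳ (trans (*-congʳ (sym (X-central a))) (*-assoc _ _ _))) ⟩
      X * (C * e) + (X * (a * Z) + Y * Z)   ≈⟨ sym (+-assoc _ _ _) ⟩
      (X * (C * e) + X * (a * Z)) + Y * Z   ≈⟨ +-congʳ (sym (distribˡ _ _ _)) ⟩
      X * (C * e + a * Z) + Y * Z           ∎
      where
      CX-comm : C * (X * e) ≈ X * (C * e)
      CX-comm = trans (sym (*-assoc _ _ _)) (trans (*-congʳ (sym (X-central C))) (*-assoc _ _ _))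

    P*X≈B*C+s : P * X ≈ B * C + s
    P*X≈B*C+s = begin
      P * X                                   ≈⟨ *-congʳ (trans P≈ (sym (+-assoc _ _ _))) ⟩
      ((C * e + a * Z) + W) * X               ≈⟨ distribʳ _ _ _ ⟩
      (C * e + a * Z) * X + W * X             ≈⟨ +-cong (sym (X-central _)) (sym (X-central _)) ⟩
      X * (C * e + a * Z) + X * W             ≈⟨ +-cong (*-congˡ C-swap) XW≈YZ+s ⟩
      X * (e * C + Z * a) + (Y * Z + s)       ≈⟨ +-congˡ (+-congʳ YZ≈ZY) ⟩
      X * (e * C + Z * a) + (Z * Y + s)       ≈⟨ sym (+-assoc _ _ _) ⟩
      (X * (e * C + Z * a) + Z * Y) + s       ≈⟨ +-congʳ (sym B*C≈) ⟩
      B * C + s                               ∎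

    B*C≈C*B : B * C ≈ C * B
    B*C≈C*B = begin
      B * C                        ≈⟨ B*C≈ ⟩
      X * (e * C + Z * a) + Z * Y  ≈⟨ +-cong (*-congˡ (sym C-swap)) (sym YZ≈ZY) ⟩
      X * (C * e + a * Z) + Y * Z  ≈⟨ sym C*B≈ ⟩
      C * B                        ∎

module AntiAutomorphismLemmas {c ℓ : Level} (R : Ring c ℓ) (A : AntiAutomorphism R) where
  open Ring R hiding (zero)
  open AntiAutomorphism A
  open RingLemmas R
  open import Algebra.Properties.Ring R using (-‿involutive)
  open import Relation.Binary.Reasoning.Setoid setoid

  bar-1# : bar 1# ≈ 1#
  bar-1# = begin
    bar 1#                 ≈⟨ sym (*-identityʳ _) ⟩
    bar 1# * 1#            ≈⟨ *-congˡ (sym (involutive 1#)) ⟩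
    bar 1# * bar (bar 1#)  ≈⟨ sym (bar-* (bar 1#) 1#) ⟩
    bar (bar 1# * 1#)      ≈⟨ bar-cong (*-identityʳ _) ⟩
    bar (bar 1#)           ≈⟨ involutive 1# ⟩
    1#                     ∎

  bar-continuant : ∀ m (x : Fin m → Carrier) →
                   bar (continuant R m x) ≈ continuant R m (λ i → bar (x (opposite i)))
  bar-continuant zero          x = bar-1#
  bar-continuant (suc zero)    x = refl
  bar-continuant (suc (suc m)) x = begin
    bar (continuant R (suc m) (x ∘ inject₁) * x (fromℕ (suc m)) + continuant R m (x ∘ inject₁ ∘ inject₁))
      ≈⟨ bar-+ _ _ ⟩
    bar (continuant R (suc m) (x ∘ inject₁) * x (fromℕ (suc m))) + bar (continuant R m (x ∘ inject₁ ∘ inject₁))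
      ≈⟨ +-cong (bar-* _ _) (bar-continuant m (x ∘ inject₁ ∘ inject₁)) ⟩
    bar (x (fromℕ (suc m))) * bar (continuant R (suc m) (x ∘ inject₁)) + continuant R m (λ i → x̄ (suc (suc i)))
      ≈⟨ +-congʳ (*-congˡ (bar-continuant (suc m) (x ∘ inject₁))) ⟩
    x̄ zero * continuant R (suc m) (λ i → x̄ (suc i)) + continuant R m (λ i → x̄ (suc (suc i)))
      ≈⟨ sym (continuant-unfoldˡ m x̄) ⟩
    continuant R (suc (suc m)) x̄ ∎
    where
    x̄ : Fin (suc (suc m)) → Carrier
    x̄ i = bar (x (opposite i))

  quasiPalindromic-middle : ∀ k (q : Fin (suc (suc k)) → Carrier) →
    QuasiPalindromic R A (suc (suc k)) q →
    QuasiPalindromic R A k (λ i → q (suc (inject₁ i)))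
  quasiPalindromic-middle (suc k) q q-pal i =
    trans (q-pal (suc (inject₁ i)))
          (bar-cong (reflexive (≡.cong (q ∘ inject₁) (opposite-inject₁ i))))

  module Normal (normal : ∀ τ → τ * bar τ ≈ bar τ * τ) where

    normal-polarised : ∀ x y → x * bar y + y * bar x ≈ bar x * y + bar y * x
    normal-polarised x y = +-cancel-≈ˡ expanded (+-cong (normal x) (normal y))
      where
      expanded : (x * bar x + y * bar y) + (x * bar y + y * bar x)
               ≈ (bar x * x + bar y * y) + (bar x * y + bar y * x)
      expanded = begin
        (x * bar x + y * bar y) + (x * bar y + y * bar x)  ≈⟨ sym (foil _ _ _ _) ⟩
        (x + y) * (bar x + bar y)                          ≈⟨ *-congˡ (sym (bar-+ x y)) ⟩
        (x + y) * bar (x + y)                              ≈⟨ normal (x + y) ⟩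
        bar (x + y) * (x + y)                              ≈⟨ *-congʳ (bar-+ x y) ⟩
        (bar x + bar y) * (x + y)                          ≈⟨ foil _ _ _ _ ⟩
        (bar x * x + bar y * y) + (bar x * y + bar y * x)  ∎

    conjugates-commute : ∀ {a e} → a ≈ bar e → a * e ≈ e * a
    conjugates-commute {a} {e} a≈ē = begin
      a * e      ≈⟨ *-congʳ a≈ē ⟩
      bar e * e  ≈⟨ sym (normal e) ⟩
      e * bar e  ≈⟨ *-congˡ (sym a≈ē) ⟩
      e * a      ∎

    conjugates-swap : ∀ {a e Y Z} → a ≈ bar e → bar Z ≈ Y → Y * e + a * Z ≈ e * Y + Z * a
    conjugates-swap {a} {e} {Y} {Z} a≈ē Z̄≈Y = begin
      Y * e + a * Z          ≈⟨ +-comm _ _ ⟩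
      a * Z + Y * e          ≈⟨ +-cong (*-congʳ a≈ē) (*-congʳ (sym Z̄≈Y)) ⟩
      bar e * Z + bar Z * e  ≈⟨ sym (normal-polarised e Z) ⟩
      e * bar Z + Z * bar e  ≈⟨ +-cong (*-congˡ Z̄≈Y) (*-congˡ (sym a≈ē)) ⟩
      e * Y + Z * a          ∎

  continuant-determinant :
    (∀ τ → τ * bar τ ≈ bar τ * τ) → (∀ τ → bar τ ≈ τ → ∀ σ → τ * σ ≈ σ * τ) →
    ∀ k (q : Fin (suc (suc k)) → Carrier) → QuasiPalindromic R A (suc (suc k)) q →
    (continuant R (suc (suc k)) q * continuant R k (λ i → q (suc (inject₁ i)))
       ≈ continuant R (suc k) (λ i → q (suc i)) * continuant R (suc k) (q ∘ inject₁)
         + sign R (suc (suc k)))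
    × (continuant R (suc k) (λ i → q (suc i)) * continuant R (suc k) (q ∘ inject₁)
       ≈ continuant R (suc k) (q ∘ inject₁) * continuant R (suc k) (λ i → q (suc i)))
  continuant-determinant normal central zero q q-pal = whole≈ , sym q₀q₁≈q₁q₀
    where
    open Normal normal
    q₀q₁≈q₁q₀ : q zero * q (suc zero) ≈ q (suc zero) * q zero
    q₀q₁≈q₁q₀ = conjugates-commute (q-pal zero)
    whole≈ : (q zero * q (suc zero) + 1#) * 1# ≈ q (suc zero) * q zero + - - 1#
    whole≈ = trans (*-identityʳ _) (+-cong q₀q₁≈q₁q₀ (sym (-‿involutive 1#)))
  continuant-determinant normal central (suc zero) q q-pal =
    determinant-step (central q₁ (sym (q-pal (suc zero)))) (conjugates-commute (q-pal zero))
                     ends-swap q₁0≈1-1 refl (+-congˡ (sym q₀≈q₀1+0)) refl refl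
    where
    -- the step with the inner continuants [q₃,…,q₂] = 1 and [q₃,…,q₁] = 0
    open Normal normal
    q₀ q₁ q₂ : Carrier
    q₀ = q zero
    q₁ = q (suc zero)
    q₂ = q (suc (suc zero))
    ends-swap : 1# * q₂ + q₀ * 1# ≈ q₂ * 1# + 1# * q₀
    ends-swap = trans (+-cong (*-identityˡ _) (*-identityʳ _)) (sym (+-cong (*-identityʳ _) (*-identityˡ _)))
    q₁0≈1-1 : q₁ * 0# ≈ 1# * 1# + - - - 1#
    q₁0≈1-1 = begin
      q₁ * 0#          ≈⟨ zeroʳ _ ⟩
      0#               ≈⟨ sym (-‿inverseʳ 1#) ⟩
      1# + - 1#        ≈⟨ +-cong (sym (*-identityˡ _)) (-‿cong (sym (-‿involutive 1#))) ⟩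
      1# * 1# + - - - 1# ∎
    q₀≈q₀1+0 : q₀ * 1# + 0# ≈ q₀
    q₀≈q₀1+0 = trans (+-identityʳ _) (*-identityʳ _)
  continuant-determinant normal central (suc (suc k)) q q-pal =
    determinant-step (central X X̄≈X) (conjugates-commute (q-pal zero))
                     (conjugates-swap (q-pal zero) Z̄≈Y) XW≈YZ+s (proj₂ middle-identities)
                     (+-congˡ (continuant-unfoldˡ k (q ∘ inject₁ ∘ inject₁)))
                     (continuant-unfoldˡ (suc k) (q ∘ inject₁)) refl
    where
    open Normal normal
    middle : Fin (suc (suc k)) → Carrier
    middle i = q (suc (inject₁ i))
    middle-pal : QuasiPalindromic R A (suc (suc k)) middle
    middle-pal = quasiPalindromic-middle (suc (suc k)) q q-pal
    X Y Z W : Carrier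
    X = continuant R (suc (suc k)) middle
    Y = continuant R (suc k) (λ i → middle (suc i))
    Z = continuant R (suc k) (middle ∘ inject₁)
    W = continuant R k (λ i → middle (suc (inject₁ i)))
    middle-identities : X * W ≈ Y * Z + sign R (suc (suc k)) × Y * Z ≈ Z * Y
    middle-identities = continuant-determinant normal central k middle middle-pal
    X̄≈X : bar X ≈ X
    X̄≈X = trans (bar-continuant _ middle) (continuant-cong _ (sym ∘ middle-pal))
    Z̄≈Y : bar Z ≈ Y
    Z̄≈Y = trans (bar-continuant _ (middle ∘ inject₁)) (continuant-cong _ (λ i → sym (middle-pal (suc i))))
    XW≈YZ+s : X * W ≈ Y * Z + - - sign R (suc (suc k))
    XW≈YZ+s = trans (proj₁ middle-identities) (+-congˡ (sym (-‿involutive _)))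

lemma2 : {c ℓ : Level} (R : Ring c ℓ) (A : AntiAutomorphism R) →
    let open Ring R
        open AntiAutomorphism A
    in (∀ τ → τ * bar τ ≈ bar τ * τ) →
       (∀ τ → bar τ ≈ τ → ∀ σ → τ * σ ≈ σ * τ) →
       (k : ℕ) (q : Fin (suc (suc k)) → Carrier) →
       QuasiPalindromic R A (suc (suc k)) q →
       (continuant R (suc (suc k)) q * continuant R k (λ i → q (suc (inject₁ i)))
          ≈ continuant R (suc k) (λ i → q (suc i)) * continuant R (suc k) (λ i → q (inject₁ i))
            + sign R (suc (suc k)))
       × (continuant R (suc k) (λ i → q (suc i)) * continuant R (suc k) (λ i → q (inject₁ i))
            + sign R (suc (suc k))
          ≈ continuant R (suc k) (λ i → q (inject₁ i)) * continuant R (suc k) (λ i → q (suc i))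
            + sign R (suc (suc k)))
lemma2 R A normal central k q q-pal =
  map₂ (Ring.+-congʳ R) (continuant-determinant normal central k q q-pal)
  where open AntiAutomorphismLemmas R A using (continuant-determinant)
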